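{- Let $(\mathcal V,\mathcal T_\#)$ be a fann derived from $(V,\#,\preccurlyeq)$. Then every genetic bar on every basic subspraid $V_a$ ($a\in V$) is finite.
   Context: Setting: Bishop-style constructive mathematics with the induction principle for genetic bars. Pre-natural space $(V,\#,\preccurlyeq)$: $V$ countable, $\#,\preccurlyeq$ decidable, $\#$ symmetric irreflexive, $\preccurlyeq$ partial order, $a\preccurlyeq b\wedge c\#b\Rightarrow c\#a$; $a\prec b$ means $a\preccurlyeq b,a\ne b$; maximal dot $\top$. $a$ is an immediate successor of $c$ if $a\prec c$ and no $b$ has $a\prec b\prec c$; $\mathrm{suc}(c)$ is the set of these. Spraid: the dots form a trea (each $a$ has finitely many $b$ with $a\preccurlyeq b$, and all chains of immediate successors from $\top$ to $a$ have a common length), every dot contains a point, and every infinite strictly decreasing sequence of dots is a point. A fann is a spraid with $\mathrm{suc}(c)$ finite for every $c$. $V_a=\{b:b\preccurlyeq a\}$ with maximal dot $a$. Genetic bars on $V_a$: $\{a\}$ is one; if $B_b$ is a genetic bar on $V_b$ for every $b\in\mathrm{suc}(a)$, then $\bigcup_{b\in\mathrm{suc}(a)}B_b$ is a genetic bar on $V_a$; only sets so generated. -}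

module Defs where

open import Data.Nat using (ℕ; suc)
open import Data.List using (List)
open import Data.List.Membership.Propositional using (_∈_)
open import Data.List.Relation.Unary.Unique.Propositional using (Unique)
open import Data.Product using (Σ; ∃; ∃-syntax; _×_)
open import Data.Empty using (⊥)
open import Relation.Nullary using (¬_; Dec)
open import Relation.Binary.PropositionalEquality using (_≡_)
open import Function.Bundles using (_⇔_)

Subset : Set → Set₁
Subset V = V → Set

-- Bishop-finite subset: exactly enumerated by a duplicate-free list
-- (equivalently, in bijection with {1,…,n}).
Finite : {V : Set} → Subset V → Set
Finite {V} S = Σ (List V) λ xs → Unique xs × (∀ x → S x ⇔ (x ∈ xs))

record PreNatural : Set₁ where
  field
    V      : Set
    -- V countable: enumerated by ℕ (V is inhabited, since ⊤ ∈ V)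
    enum   : ℕ → V
    enum-surj : ∀ v → ∃[ n ] (enum n ≡ v)
    _#_    : V → V → Set
    _≼_    : V → V → Set
    _#?_   : ∀ a b → Dec (a # b)
    _≼?_   : ∀ a b → Dec (a ≼ b)
    #-sym    : ∀ {a b} → a # b → b # a
    #-irrefl : ∀ {a} → ¬ (a # a)
    ≼-refl    : ∀ {a} → a ≼ a
    ≼-trans   : ∀ {a b c} → a ≼ b → b ≼ c → a ≼ c
    ≼-antisym : ∀ {a b} → a ≼ b → b ≼ a → a ≡ b
    #-≼     : ∀ {a b c} → a ≼ b → c # b → c # a
    ⊤      : V
    ⊤-max  : ∀ a → a ≼ ⊤

  _≺_ : V → V → Set
  a ≺ b = (a ≼ b) × ¬ (a ≡ b)

  ImmSuc : V → V → Set
  ImmSuc a c = (a ≺ c) × (¬ (Σ V λ b → (a ≺ b) × (b ≺ c)))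

  sucSet : V → Subset V
  sucSet c a = ImmSuc a c

  data ChainTo : ℕ → V → Set where
    start : ChainTo 0 ⊤
    step  : ∀ {n c a} → ChainTo n c → ImmSuc a c → ChainTo (suc n) a

  IsPoint : (ℕ → V) → Set
  IsPoint p = (∀ n → p (suc n) ≼ p n)
            × (∀ a b → a # b → ∃[ n ] ((p n # a) ⊎' (p n # b)))
    where
      open import Data.Sum using () renaming (_⊎_ to _⊎'_)

  Contains : V → (ℕ → V) → Set
  Contains a p = ∃[ n ] (p n ≼ a)

  record IsSpraid : Set where
    field
      above-finite : ∀ a → Finite (λ b → a ≼ b)
      chain-length : ∀ {a m n} → ChainTo m a → ChainTo n a → m ≡ n
      dot-point : ∀ a → Σ (ℕ → V) λ p → IsPoint p × Contains a p
      decr-point : ∀ (p : ℕ → V) → (∀ n → p (suc n) ≺ p n) → IsPoint p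

  record IsFann : Set where
    field
      spraid : IsSpraid
      suc-finite : ∀ c → Finite (sucSet c)

  -- Genetic bars on V_a, generated inductively (sets up to extensional equality).
  data IsGeneticBar : V → Subset V → Set₁ where
    single : ∀ {a} {B : Subset V} → (∀ x → B x ⇔ (x ≡ a)) → IsGeneticBar a B
    union  : ∀ {a} {B : Subset V} (F : V → Subset V)
           → (∀ b → ImmSuc b a → IsGeneticBar b (F b))
           → (∀ x → B x ⇔ (Σ V λ b → ImmSuc b a × F b x))
           → IsGeneticBar a B

module Submission where

open import Defs
open PreNatural using (IsFann; IsGeneticBar; V)

open import Data.List using (List; []; _∷_; _++_; [_]; deduplicate)
open import Data.List.Membership.Propositional using (_∈_)
open import Data.List.Membership.Propositional.Properties using (++-∈⇔; deduplicate-∈⇔)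
open import Data.List.Relation.Unary.Any using (here; there)
open import Data.List.Relation.Unary.Unique.DecPropositional.Properties using (deduplicate-!)
open import Data.Product using (Σ; _×_; _,_)
open import Data.Sum using (_⊎_; inj₁; inj₂)
open import Data.Sum.Function.Propositional using (_⊎-⇔_)
open import Function.Bundles using (_⇔_; mk⇔; Equivalence)
import Function.Properties.Equivalence as ⇔
open import Relation.Binary.Definitions using (DecidableEquality)
open import Relation.Binary.PropositionalEquality using (_≡_; refl)
open import Relation.Nullary using (yes; no)

-- A genetic bar is built from singletons by unions indexed over suc(a), which is
-- finite in a fann; so induction on the bar yields a list enumerating it, possibly
-- with repetitions. Equality of dots is decidable, since ≼ is a decidable partial
-- order, so the repetitions can be removed, giving a Bishop-finite set.

Listed : {A : Set} → Subset A → Set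
Listed {A} S = Σ (List A) λ xs → ∀ x → S x ⇔ (x ∈ xs)

module _ {A : Set} where

  listed-resp-⇔ : {S T : Subset A} → (∀ x → S x ⇔ T x) → Listed T → Listed S
  listed-resp-⇔ S⇔T (xs , T⇔xs) = xs , λ x → ⇔.trans (S⇔T x) (T⇔xs x)

  listed-≡ : (a : A) → Listed (_≡ a)
  listed-≡ a = [ a ] , λ x → mk⇔ here λ { (here x≡a) → x≡a ; (there ()) }

  listed-∪ : {S T : Subset A} → Listed S → Listed T → Listed (λ x → S x ⊎ T x)
  listed-∪ (xs , S⇔xs) (ys , T⇔ys) =
    xs ++ ys , λ x → ⇔.trans (S⇔xs x ⊎-⇔ T⇔ys x) (⇔.sym ++-∈⇔)

  ⋃-∷-⇔ : (F : A → Subset A) (j : A) (is : List A) (x : A) →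
          (Σ A λ i → i ∈ j ∷ is × F i x) ⇔ (F j x ⊎ Σ A λ i → i ∈ is × F i x)
  ⋃-∷-⇔ F j is x = mk⇔ split join
    where
    split : (Σ A λ i → i ∈ j ∷ is × F i x) → F j x ⊎ Σ A λ i → i ∈ is × F i x
    split (i , here refl , Fix) = inj₁ Fix
    split (i , there i∈is , Fix) = inj₂ (i , i∈is , Fix)
    join : F j x ⊎ (Σ A λ i → i ∈ is × F i x) → Σ A λ i → i ∈ j ∷ is × F i x
    join (inj₁ Fjx) = j , here refl , Fjx
    join (inj₂ (i , i∈is , Fix)) = i , there i∈is , Fix

  listed-⋃-list : (F : A → Subset A) (is : List A) → (∀ i → i ∈ is → Listed (F i)) →
                  Listed (λ x → Σ A λ i → i ∈ is × F i x)
  listed-⋃-list F [] _ = [] , λ x → mk⇔ (λ { (_ , () , _) }) λ ()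
  listed-⋃-list F (j ∷ is) listedF = listed-resp-⇔ (⋃-∷-⇔ F j is)
    (listed-∪ (listedF j (here refl)) (listed-⋃-list F is λ i i∈is → listedF i (there i∈is)))

  listed-⋃ : {I : Subset A} (F : A → Subset A) → Listed I → (∀ i → I i → Listed (F i)) →
             Listed (λ x → Σ A λ i → I i × F i x)
  listed-⋃ {I} F (is , I⇔is) listedF =
    listed-resp-⇔ (λ x → mk⇔ (λ { (i , Ii , Fix) → i , to i Ii , Fix })
                             (λ { (i , i∈is , Fix) → i , from i i∈is , Fix }))
      (listed-⋃-list F is λ i i∈is → listedF i (from i i∈is))
    where
    to : ∀ i → I i → i ∈ is
    to i = Equivalence.to (I⇔is i)
    from : ∀ i → i ∈ is → I i
    from i = Equivalence.from (I⇔is i)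

  listed⇒finite : DecidableEquality A → {S : Subset A} → Listed S → Finite S
  listed⇒finite _≟_ (xs , S⇔xs) =
    deduplicate _≟_ xs , deduplicate-! _≟_ xs , λ x → ⇔.trans (S⇔xs x) (deduplicate-∈⇔ _≟_)

module _ (P : PreNatural) where
  open PreNatural P hiding (IsFann; IsGeneticBar) renaming (V to Dot)

  ≡-dec : DecidableEquality Dot
  ≡-dec a b with a ≼? b | b ≼? a
  ... | yes a≼b | yes b≼a = yes (≼-antisym a≼b b≼a)
  ... | no a⋠b  | _       = no λ { refl → a⋠b ≼-refl }
  ... | yes _   | no b⋠a  = no λ { refl → b⋠a ≼-refl }

  geneticBar-listed : (∀ c → Finite (sucSet c)) →
                      ∀ {a B} → IsGeneticBar P a B → Listed B
  geneticBar-listed sucFinite {a} (single B⇔a) = listed-resp-⇔ B⇔a (listed-≡ a)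
  geneticBar-listed sucFinite {a} (union F bars B⇔⋃) with sucFinite a
  ... | (bs , _ , suc⇔bs) = listed-resp-⇔ B⇔⋃
        (listed-⋃ F (bs , suc⇔bs) λ b b∈suc → geneticBar-listed sucFinite (bars b b∈suc))

mainTheorem12 : (P : PreNatural) → IsFann P →
    (a : V P) (B : Subset (V P)) → IsGeneticBar P a B → Finite B
mainTheorem12 P fann a B bar =
  listed⇒finite (≡-dec P) (geneticBar-listed P (PreNatural.IsFann.suc-finite fann) bar)
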